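{- Let $p\neq 2$ and assume the setting in the context with $k=c_0=1$ (so $L/\mathbb{Q}_p$ is unramified). Let $\psi_0$ be the trivial character modulo $p$. Then $$\gamma p^2\,\widehat{H}(\psi_0,1,1,1)=p\sum_{y\in(\mathbb{Z}/p\mathbb{Z})^\times}\mathrm{Kl}_{\mathrm{ns}}(y)S(y,1;p)-\tau_L(\xi),$$ where $\mathrm{Kl}_{\mathrm{ns}}(y)=\sum_{t\in\mathcal{O}_L/p\mathcal{O}_L,\ \mathrm{Nm}(t)=y}\xi(t)e_p(-\mathrm{Tr}(t))$, $\tau_L(\xi)=\sum_{t\in(\mathcal{O}_L/p\mathcal{O}_L)^\times}\xi(t)e_p(-\mathrm{Tr}(t))$, and $S(y,1;p)=\sum_{x\in(\mathbb{Z}/p)^\times}e_p(xy+\bar x)$ is the Kloosterman sum.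
   Context: Let $p$ be an odd prime, $e_{p^k}(x)=e^{2\pi ix/p^k}$. Let $L/\mathbb{Q}_p$ be a quadratic extension with ring of integers $\mathcal{O}_L$, ramification index $e_L$, discriminant exponent $d$, norm $\mathrm{Nm}$, trace $\mathrm{Tr}$; $\eta_L$ the quadratic character of $\mathbb{Q}_p^\times$ trivial on norms. Let $\xi$ be a character of $L^\times$ with $\xi\neq\bar\xi$, $\xi|_{\mathbb{Q}_p^\times}=\eta_L$, $(L/\mathbb{Q}_p,\xi)$ admissible; $c_0=c(\xi)/e_L$ with $c(\xi)$ the conductor exponent; $\xi(t)$ for $t$ in a residue ring means $\xi$ of a unit lift ($0$ for non-units). Let $\gamma$ be a fixed complex number of modulus 1 depending only on $L$. Define $H(m,n;p^k)=\bar\gamma p^{ -d/2}\sum_{t\in(\mathcal{O}_L/p^k)^\times,\ \mathrm{Nm}(t)\equiv mn\ (p^k)}\xi(t)e_{p^k}(-\mathrm{Tr}(t))$ if $p\nmid mn$, $0$ otherwise, and $\widehat{H}(\psi,a_1,a_2,a_3)=p^{ -2k}\sum_{u,x_1,x_2,x_3\bmod p^k}\bar\psi(u)H(\bar ux_1x_2x_3,1;p^k)e_{p^k}(a_1x_1+a_2x_2+a_3x_3-ua_1a_2a_3)$. -}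

module Defs where

open import Level using (Level)
open import Algebra.Bundles using (CommutativeRing)
open import Data.Nat as ℕ using (ℕ; zero; suc; NonZero)
open import Data.Nat.DivMod using (_%_)
open import Data.Nat.Primality using (Prime; prime⇒nonZero)
open import Data.Fin using (Fin; toℕ)
open import Data.Product using (_×_; _,_; ∃)
open import Data.Bool using (Bool; if_then_else_; _∧_)
open import Relation.Nullary using (¬_)
open import Relation.Nullary.Decidable using (⌊_⌋)
open import Relation.Binary.PropositionalEquality using (_≡_)

-- Values are taken in an arbitrary commutative ring R (standing in for ℂ):
--   ζ     : a primitive p-th root of unity (e_p(x) = ζ^x),
--   γ γ'  : γ and its conjugate γ̄ = γ⁻¹ (|γ| = 1),
--   pinv  : p⁻¹ in R,
--   ε     : a quadratic non-residue mod p, so that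
--           𝒪_L / p𝒪_L ≅ 𝔽_p[√ε] = { a + b√ε : a b ∈ ℤ/p },
--   ξ     : the character ξ of L^×, viewed on 𝒪_L/p𝒪_L (c(ξ)=1),
--           with ξ = 0 on non-units (only 0 here).
-- Residues mod p are natural numbers, reduced with _%_ p.
-- ================================================================

module Setting {c ℓ : Level} (R : CommutativeRing c ℓ) (p : ℕ) (pp : Prime p)
               (ε : ℕ) (ζ γ' pinv : CommutativeRing.Carrier R)
               (ξ : ℕ × ℕ → CommutativeRing.Carrier R) where

  open CommutativeRing R

  instance
    p-nz : NonZero p
    p-nz = prime⇒nonZero pp

  pow : Carrier → ℕ → Carrier
  pow x zero = 1#
  pow x (suc n) = x * pow x n

  ι : ℕ → Carrier
  ι zero = 0#
  ι (suc n) = 1# + ι n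

  Σ[_]_ : (n : ℕ) → (Fin n → Carrier) → Carrier
  Σ[ zero ] f = 0#
  Σ[ suc n ] f = f Fin.zero + Σ[ n ] (λ i → f (Fin.suc i))

  red : ℕ → ℕ
  red n = n % p

  neg : ℕ → ℕ
  neg n = red (p ℕ.∸ red n)

  isUnit : ℕ → Bool
  isUnit n = ⌊ red n ℕ.≟ 0 ⌋

  -- inverse mod p (Fermat): x̄ = x^(p-2)
  inv : ℕ → ℕ
  inv x = red (x ℕ.^ (p ℕ.∸ 2))

  e : ℕ → Carrier
  e n = pow ζ (red n)

  -- 𝒪_L / p𝒪_L = 𝔽_p[√ε], element (a , b) = a + b √ε
  OL : Set
  OL = ℕ × ℕ

  mulL : OL → OL → OL
  mulL (a , b) (c' , d) = red (a ℕ.* c' ℕ.+ ε ℕ.* b ℕ.* d) , red (a ℕ.* d ℕ.+ b ℕ.* c')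

  conjL : OL → OL
  conjL (a , b) = (red a , neg b)

  Nm : OL → ℕ
  Nm (a , b) = red (a ℕ.* a ℕ.+ (p ℕ.∸ 1) ℕ.* ε ℕ.* b ℕ.* b)

  Tr : OL → ℕ
  Tr (a , b) = red (2 ℕ.* a)

  -- t is zero in 𝒪_L/p  (the unique non-unit)
  isZeroL : OL → Bool
  isZeroL (a , b) = ⌊ red a ℕ.≟ 0 ⌋ ∧ ⌊ red b ℕ.≟ 0 ⌋

  ΣL : (OL → Carrier) → Carrier
  ΣL f = Σ[ p ] (λ a → Σ[ p ] (λ b → f (toℕ a , toℕ b)))

  ΣU : (ℕ → Carrier) → Carrier
  ΣU f = Σ[ p ] (λ x → if ⌊ toℕ x ℕ.≟ 0 ⌋ then 0# else f (toℕ x))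

  Klns : ℕ → Carrier
  Klns y = ΣL (λ t → if ⌊ Nm t ℕ.≟ red y ⌋ then ξ t * e (neg (Tr t)) else 0#)

  τL : Carrier
  τL = ΣL (λ t → if isZeroL t then 0# else ξ t * e (neg (Tr t)))

  S : ℕ → ℕ → Carrier
  S y z = ΣU (λ x → e (x ℕ.* y ℕ.+ z ℕ.* inv x))

  -- H(m,n;p) for k = 1 and d = 0 (unramified, so p^{-d/2} = 1)
  H : ℕ → ℕ → Carrier
  H m n = if ⌊ red (m ℕ.* n) ℕ.≟ 0 ⌋ then 0#
          else γ' * ΣL (λ t → if isZeroL t then 0#
                               else if ⌊ Nm t ℕ.≟ red (m ℕ.* n) ⌋
                                    then ξ t * e (neg (Tr t)) else 0#)

  -- trivial character mod p (real-valued, so ψ̄₀ = ψ₀)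
  ψ₀ : ℕ → Carrier
  ψ₀ u = if ⌊ red u ℕ.≟ 0 ⌋ then 0# else 1#

  Hhat₀ : Carrier
  Hhat₀ = (pinv * pinv) *
    Σ[ p ] (λ u → Σ[ p ] (λ x₁ → Σ[ p ] (λ x₂ → Σ[ p ] (λ x₃ →
      ψ₀ (toℕ u)
      * H (inv (toℕ u) ℕ.* toℕ x₁ ℕ.* toℕ x₂ ℕ.* toℕ x₃) 1
      * e (toℕ x₁ ℕ.+ toℕ x₂ ℕ.+ toℕ x₃ ℕ.+ neg (toℕ u))))))

  PrimRoot : Set ℓ
  PrimRoot = (pow ζ p ≈ 1#) × (Σ[ p ] (λ i → pow ζ (toℕ i)) ≈ 0#)

  -- ξ is a character of (𝒪_L/p)^× (extended by 0), with ξ|_{ℤ_p^×} = η_L = 1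
  -- (η_L is unramified) and ξ ≠ ξ̄.
  CharHyp : Set ℓ
  CharHyp =
      ((s t : OL) → ξ (mulL s t) ≈ ξ s * ξ t)
    × (ξ (1 , 0) ≈ 1#)
    × ((a b : ℕ) → ξ (a , b) ≈ ξ (red a , red b))
    × (ξ (0 , 0) ≈ 0#)
    × ((a : ℕ) → ¬ (red a ≡ 0) → ξ (a , 0) ≈ 1#)
    × ∃ (λ (t : OL) → ¬ (ξ t ≈ ξ (conjL t)))

{-# OPTIONS --safe #-}
-- Unfolding H and exchanging sums gives γ p² Ĥ(ψ₀,1,1,1) = Σ_{t ≠ 0} ξ(t) e_p(−Tr t) C(Nm t), where
-- C(n) = Σ e_p(x₁ + x₂ + x₃ − u) over units u, x₁, x₂, x₃ with x₁x₂x₃ = nu; Nm t is a unit for t ≠ 0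
-- because ε is a non-residue. The constraint fixes x₃ = n u x̄₁x̄₂, and orthogonality of e_p in u gives
-- Σ_u e_p(u(n x̄₁x̄₂ − 1)) = p·[x₂ = n x̄₁] − 1, so C(n) = p Σ_{x₁} e_p(x₁ + n x̄₁) − (Σ_x e_p(x))² = p S(n,1;p) − 1.
-- Summing over t gives the right-hand side.
module Submission where

open import Defs
open import Level using (Level; 0ℓ)
open import Algebra.Bundles using (CommutativeRing; CommutativeMonoid; AbelianGroup)
import Data.Nat as ℕ
open ℕ using (ℕ; zero; suc; NonZero; _<_)
import Data.Nat.Properties as ℕP
open import Data.Nat.Tactic.RingSolver using (solve-∀)
open import Data.Nat.DivMod
  using (_%_; _/_; m≡m%n+[m/n]*n; m%n<n; m%n%n≡m%n; %-distribˡ-+; %-distribˡ-*; n%n≡0; m*n%n≡0; m<n⇒m%n≡m)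
open import Data.Nat.Primality using (Prime; prime⇒nonZero; prime⇒nonTrivial; prime⇒irreducible; euclidsLemma)
open import Data.Nat.Divisibility using (m%n≡0⇒n∣m; n∣m⇒m%n≡0)
open import Data.Nat.Coprimality using (Coprime; coprime-Bézout)
open import Data.Nat.GCD using (module Bézout)
open import Data.Fin as Fin using (Fin; toℕ; fromℕ<)
open import Data.Fin.Properties using (toℕ-fromℕ<; toℕ-injective; toℕ<n; punchInᵢ≢i)
open import Data.Vec.Functional using (removeAt)
open import Data.Fin.Permutation using (Permutation; permutation; _⟨$⟩ʳ_)
open import Data.Sum using (_⊎_; inj₁; inj₂; [_,_])
open import Data.Empty using (⊥-elim)
import Algebra.Properties.Ring as RingProperties
import Algebra.Properties.AbelianGroup as AbelianGroupProperties
import Algebra.Properties.CommutativeSemigroup as CommSemigroupProperties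
import Algebra.Properties.CommutativeMonoid.Sum as MonoidSum
import Algebra.Properties.Semiring.Sum as SemiringSum
import Algebra.Solver.Ring.NaturalCoefficients.Default as NatCoeffSolver
import Relation.Binary.Reasoning.Setoid as SetoidReasoning
open import Data.Product using (_×_; _,_; ∃; proj₁; proj₂)
open import Relation.Nullary using (¬_; Dec; yes; no)
open import Relation.Nullary.Decidable using (⌊_⌋; isYes≗does; dec-true; dec-false)
open import Data.Bool using (true; false; if_then_else_)
open import Function using (_∘_)
open import Relation.Binary.Structures using (IsEquivalence)
open import Relation.Binary.PropositionalEquality as ≡ using (_≡_)

module _ {a} {A : Set a} {x y : A} where

  if-yes : ∀ {m n} → m ≡ n → (if ⌊ m ℕ.≟ n ⌋ then x else y) ≡ x
  if-yes {m} {n} m≡n = ≡.cong (if_then x else y) (≡.trans (isYes≗does (m ℕ.≟ n)) (dec-true (m ℕ.≟ n) m≡n))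

  if-no : ∀ {m n} → ¬ m ≡ n → (if ⌊ m ℕ.≟ n ⌋ then x else y) ≡ y
  if-no {m} {n} m≢n = ≡.cong (if_then x else y) (≡.trans (isYes≗does (m ℕ.≟ n)) (dec-false (m ℕ.≟ n) m≢n))

module _ {c ℓ} (M : CommutativeMonoid c ℓ) where
  open CommutativeMonoid M
  open MonoidSum M
  open SetoidReasoning setoid

  sum-single : ∀ {n} (f : Fin n → Carrier) (j : Fin n) → (∀ i → ¬ i ≡ j → f i ≈ ε) → sum f ≈ f j
  sum-single {suc n} f j f≈ε = begin
    sum f                      ≈⟨ sum-remove {i = j} f ⟩
    f j ∙ sum (removeAt f j)   ≈⟨ ∙-congˡ (sum-cong-≋ λ k → f≈ε (Fin.punchIn j k) (punchInᵢ≢i j k)) ⟩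
    f j ∙ sum {n} (λ _ → ε)    ≈⟨ ∙-congˡ (sum-replicate-zero n) ⟩
    f j ∙ ε                    ≈⟨ identityʳ (f j) ⟩
    f j                        ∎

module _ {c ℓ} (G : AbelianGroup c ℓ) where
  open AbelianGroup G
  open MonoidSum commutativeMonoid
  open AbelianGroupProperties G using (ε⁻¹≈ε; ⁻¹-∙-comm)

  sum-⁻¹ : ∀ {n} (f : Fin n → Carrier) → sum (λ i → f i ⁻¹) ≈ sum f ⁻¹
  sum-⁻¹ {zero}  f = sym ε⁻¹≈ε
  sum-⁻¹ {suc n} f = trans (∙-congˡ (sum-⁻¹ (λ i → f (Fin.suc i)))) (⁻¹-∙-comm _ _)

module Residues (n : ℕ) .{{_ : NonZero n}} where

  open import Data.Nat using (_+_; _*_; _∸_)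

  infix 4 _≡ₘ_
  _≡ₘ_ : ℕ → ℕ → Set
  a ≡ₘ b = a % n ≡ b % n

  ≡⇒≡ₘ : ∀ {a b} → a ≡ b → a ≡ₘ b
  ≡⇒≡ₘ = ≡.cong (_% n)

  %-≡ₘ : ∀ a → a % n ≡ₘ a
  %-≡ₘ a = m%n%n≡m%n a n

  +-congₘ : ∀ {a b c d} → a ≡ₘ b → c ≡ₘ d → a + c ≡ₘ b + d
  +-congₘ {a} {b} {c} {d} a≡b c≡d = begin
    (a + c) % n             ≡⟨ %-distribˡ-+ a c n ⟩
    (a % n + c % n) % n     ≡⟨ ≡.cong₂ (λ x y → (x + y) % n) a≡b c≡d ⟩
    (b % n + d % n) % n     ≡⟨ %-distribˡ-+ b d n ⟨
    (b + d) % n             ∎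
    where open ≡.≡-Reasoning

  *-congₘ : ∀ {a b c d} → a ≡ₘ b → c ≡ₘ d → a * c ≡ₘ b * d
  *-congₘ {a} {b} {c} {d} a≡b c≡d = begin
    (a * c) % n             ≡⟨ %-distribˡ-* a c n ⟩
    (a % n * (c % n)) % n   ≡⟨ ≡.cong₂ (λ x y → (x * y) % n) a≡b c≡d ⟩
    (b % n * (d % n)) % n   ≡⟨ %-distribˡ-* b d n ⟨
    (b * d) % n             ∎
    where open ≡.≡-Reasoning

  infix 4 _≟ₘ_
  _≟ₘ_ : ∀ a b → Dec (a ≡ₘ b)
  a ≟ₘ b = a % n ℕ.≟ b % n

  -ₘ_ : ℕ → ℕ
  -ₘ a = n ∸ a % n

  +-inverseʳₘ : ∀ a → a + -ₘ a ≡ₘ 0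
  +-inverseʳₘ a = begin
    (a + (n ∸ a % n)) % n       ≡⟨ +-congₘ (%-≡ₘ a) ≡.refl ⟨
    (a % n + (n ∸ a % n)) % n   ≡⟨ ≡⇒≡ₘ (ℕP.m+[n∸m]≡n (ℕP.<⇒≤ (m%n<n a n))) ⟩
    n % n                       ≡⟨ n%n≡0 n ⟩
    0                           ≡⟨ m*n%n≡0 0 n ⟨
    0 % n                       ∎
    where open ≡.≡-Reasoning

  residueRing : CommutativeRing 0ℓ 0ℓ
  residueRing = record
    { Carrier = ℕ ; _≈_ = _≡ₘ_ ; _+_ = _+_ ; _*_ = _*_ ; -_ = -ₘ_ ; 0# = 0 ; 1# = 1
    ; isCommutativeRing = record
      { isRing = record
        { +-isAbelianGroup = record
          { isGroup = record
            { isMonoid = record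
              { isSemigroup = record
                { isMagma = record { isEquivalence = ≡ₘ-isEquivalence ; ∙-cong = +-congₘ }
                ; assoc = λ a b c → ≡⇒≡ₘ (ℕP.+-assoc a b c) }
              ; identity = (λ a → ≡.refl) , (λ a → ≡⇒≡ₘ (ℕP.+-identityʳ a)) }
            ; inverse = (λ a → ≡.trans (≡⇒≡ₘ (ℕP.+-comm (-ₘ a) a)) (+-inverseʳₘ a)) , +-inverseʳₘ
            ; ⁻¹-cong = ≡.cong (λ r → (n ∸ r) % n) }
          ; comm = λ a b → ≡⇒≡ₘ (ℕP.+-comm a b) }
        ; *-cong = *-congₘ
        ; *-assoc = λ a b c → ≡⇒≡ₘ (ℕP.*-assoc a b c)
        ; *-identity = (λ a → ≡⇒≡ₘ (ℕP.*-identityˡ a)) , (λ a → ≡⇒≡ₘ (ℕP.*-identityʳ a))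
        ; distrib = (λ a b c → ≡⇒≡ₘ (ℕP.*-distribˡ-+ a b c)) , (λ a b c → ≡⇒≡ₘ (ℕP.*-distribʳ-+ a b c)) }
      ; *-comm = λ a b → ≡⇒≡ₘ (ℕP.*-comm a b) } }
    where
    ≡ₘ-isEquivalence : IsEquivalence _≡ₘ_
    ≡ₘ-isEquivalence = record { refl = ≡.refl ; sym = ≡.sym ; trans = ≡.trans }

module PrimeResidues (p : ℕ) (pp : Prime p) where

  open import Data.Nat using (_+_; _*_; _∸_; _^_)

  instance
    p-nonZero : NonZero p
    p-nonZero = prime⇒nonZero pp

  open Residues p public
  open CommutativeRing residueRing using (setoid; *-commutativeMonoid) renaming (refl to reflₘ; sym to symₘ)
  open RingProperties (CommutativeRing.ring residueRing)
    using (+-inverseˡ-unique; +-inverseʳ-unique; -‿distribʳ-*; +-cancelʳ; x∙y⁻¹≈ε⇒x≈y)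
  open SetoidReasoning setoid
  module ≡ₘ-Reasoning = SetoidReasoning setoid

  1<p : 1 < p
  1<p = ℕ.nonTrivial⇒n>1 p {{prime⇒nonTrivial pp}}

  0%p : 0 % p ≡ 0
  0%p = m*n%n≡0 0 p

  Unit : ℕ → Set
  Unit a = ¬ a % p ≡ 0

  nonzero⇒unit : ∀ {a} → a < p → ¬ a ≡ 0 → Unit a
  nonzero⇒unit a<p a≢0 a%p≡0 = a≢0 (≡.trans (≡.sym (m<n⇒m%n≡m a<p)) a%p≡0)

  unit-cong : ∀ {a b} → a ≡ₘ b → Unit a → Unit b
  unit-cong a≡b ua b%p≡0 = ua (≡.trans a≡b b%p≡0)

  unit-* : ∀ {a b} → Unit a → Unit b → Unit (a * b)
  unit-* {a} {b} ua ub ab%p≡0 with euclidsLemma a b pp (m%n≡0⇒n∣m (a * b) p ab%p≡0)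
  ... | inj₁ p∣a = ua (n∣m⇒m%n≡0 a p p∣a)
  ... | inj₂ p∣b = ub (n∣m⇒m%n≡0 b p p∣b)

  unit-1 : Unit 1
  unit-1 = nonzero⇒unit 1<p λ ()

  invertible⇒unit : ∀ {a b} → a * b ≡ₘ 1 → Unit b
  invertible⇒unit {a} {b} ab≡1 b%p≡0 = unit-1 (≡.trans (begin
    1      ≈⟨ ab≡1 ⟨
    a * b  ≈⟨ *-congₘ {a} reflₘ (≡.trans b%p≡0 (≡.sym 0%p)) ⟩
    a * 0  ≡⟨ ℕP.*-zeroʳ a ⟩
    0      ∎) 0%p)

  unit⇒coprime : ∀ {a} → Unit a → Coprime a p
  unit⇒coprime {a} ua (d∣a , d∣p) with prime⇒irreducible pp d∣p
  ... | inj₁ d≡1 = d≡1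
  ... | inj₂ ≡.refl = ⊥-elim (ua (n∣m⇒m%n≡0 a p d∣a))

  unit⇒invertible : ∀ {a} → Unit a → ∃ λ b → a * b ≡ₘ 1
  unit⇒invertible {a} ua with coprime-Bézout (unit⇒coprime ua)
  ... | Bézout.+- x y 1+yp≡xa = x , (begin
    a * x       ≡⟨ ≡.trans (ℕP.*-comm a x) (≡.sym 1+yp≡xa) ⟩
    1 + y * p   ≈⟨ +-congₘ reflₘ (≡.trans (m*n%n≡0 y p) (≡.sym 0%p)) ⟩
    1 + 0       ≡⟨ ℕP.+-identityʳ 1 ⟩
    1           ∎)
  ... | Bézout.-+ x y 1+xa≡yp = -ₘ x , (begin
    a * -ₘ x     ≈⟨ -‿distribʳ-* a x ⟨
    -ₘ (a * x)   ≈⟨ +-inverseˡ-unique 1 (a * x) (begin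
                      1 + a * x   ≡⟨ ≡.cong (1 +_) (ℕP.*-comm a x) ⟩
                      1 + x * a   ≡⟨ 1+xa≡yp ⟩
                      y * p       ≈⟨ ≡.trans (m*n%n≡0 y p) (≡.sym 0%p) ⟩
                      0           ∎) ⟨
    1            ∎)

  *-cancelʳ-unit : ∀ {a b c} → Unit c → a * c ≡ₘ b * c → a ≡ₘ b
  *-cancelʳ-unit {a} {b} {c} uc ac≡bc = begin
    a             ≈⟨ ≡⇒≡ₘ (ℕP.*-identityʳ a) ⟨
    a * 1         ≈⟨ *-congₘ {a} reflₘ cc′≡1 ⟨
    a * (c * c′)  ≈⟨ ≡⇒≡ₘ (ℕP.*-assoc a c c′) ⟨
    a * c * c′    ≈⟨ *-congₘ {a * c} ac≡bc reflₘ ⟩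
    b * c * c′    ≈⟨ ≡⇒≡ₘ (ℕP.*-assoc b c c′) ⟩
    b * (c * c′)  ≈⟨ *-congₘ {b} reflₘ cc′≡1 ⟩
    b * 1         ≈⟨ ≡⇒≡ₘ (ℕP.*-identityʳ b) ⟩
    b             ∎
    where
    c′ = proj₁ (unit⇒invertible uc)
    cc′≡1 = proj₂ (unit⇒invertible uc)

  residue : ℕ → Fin p
  residue a = fromℕ< (m%n<n a p)

  toℕ-residue : ∀ a → toℕ (residue a) ≡ a % p
  toℕ-residue a = toℕ-fromℕ< (m%n<n a p)

  toℕ%p : ∀ (i : Fin p) → toℕ i % p ≡ toℕ i
  toℕ%p i = m<n⇒m%n≡m (toℕ<n i)

  residue-unique : ∀ {a} {i : Fin p} → a ≡ₘ toℕ i → residue a ≡ i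
  residue-unique {a} {i} a≡i = toℕ-injective (≡.trans (toℕ-residue a) (≡.trans a≡i (toℕ%p i)))

  scaling : ∀ {a} → Unit a → Permutation p p
  scaling {a} ua = permutation (scale a) (scale b) (scale-inverse {a} ab≡1) (scale-inverse {b} ba≡1)
    where
    b = proj₁ (unit⇒invertible ua)
    ab≡1 = proj₂ (unit⇒invertible ua)
    ba≡1 = ≡.trans (≡⇒≡ₘ (ℕP.*-comm b a)) ab≡1
    scale : ℕ → Fin p → Fin p
    scale x i = residue (x * toℕ i)
    scale-inverse : ∀ {x y} → x * y ≡ₘ 1 → ∀ i → scale x (scale y i) ≡ i
    scale-inverse {x} {y} xy≡1 i = residue-unique (begin
      x * toℕ (residue (y * toℕ i))   ≡⟨ ≡.cong (x *_) (toℕ-residue (y * toℕ i)) ⟩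
      x * ((y * toℕ i) % p)           ≈⟨ *-congₘ {x} reflₘ (%-≡ₘ (y * toℕ i)) ⟩
      x * (y * toℕ i)                 ≡⟨ ℕP.*-assoc x y (toℕ i) ⟨
      x * y * toℕ i                   ≈⟨ *-congₘ {x * y} xy≡1 reflₘ ⟩
      1 * toℕ i                       ≡⟨ ℕP.*-identityˡ (toℕ i) ⟩
      toℕ i                           ∎)

  toℕ-scaling : ∀ {a} (ua : Unit a) i → toℕ (scaling ua ⟨$⟩ʳ i) ≡ (a * toℕ i) % p
  toℕ-scaling {a} ua i = toℕ-residue (a * toℕ i)

  open MonoidSum *-commutativeMonoid using ()
    renaming (sum to ∏; sum-permute to ∏-permute; ∑-distrib-+ to ∏-distrib-*; sum-cong-≋ to ∏-cong)

  ∏-unit : ∀ {n} (f : Fin n → ℕ) → (∀ i → Unit (f i)) → Unit (∏ f)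
  ∏-unit {zero}  f uf = unit-1
  ∏-unit {suc n} f uf = unit-* (uf Fin.zero) (∏-unit (λ i → f (Fin.suc i)) (λ i → uf (Fin.suc i)))

  ∏-const : ∀ n a → ∏ {n} (λ _ → a) ≡ a ^ n
  ∏-const zero    a = ≡.refl
  ∏-const (suc n) a = ≡.cong (a *_) (∏-const n a)

  -- Fermat's little theorem, by comparing the product of the units with the
  -- product of their multiples by a; the residue 0 is counted as 1 on both sides.
  fermat : ∀ {a} → Unit a → a ^ (p ∸ 1) ≡ₘ 1
  fermat {a} ua = *-cancelʳ-unit (∏-unit (λ i → ⟨ toℕ i ⟩) (λ i → ⟨⟩-unit (toℕ i) (toℕ<n i))) (begin
    a ^ (p ∸ 1) * P                           ≡⟨ ≡.cong (_* P) (∏-weight p) ⟨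
    ∏ {p} (λ i → weight (toℕ i)) * P          ≈⟨ ∏-distrib-* {p} (λ i → weight (toℕ i)) (λ i → ⟨ toℕ i ⟩) ⟨
    ∏ {p} (λ i → weight (toℕ i) * ⟨ toℕ i ⟩)  ≈⟨ ∏-cong (λ i → symₘ (⟨a*⟩ (toℕ i) (toℕ<n i))) ⟩
    ∏ {p} (λ i → ⟨ (a * toℕ i) % p ⟩)         ≈⟨ ∏-cong (λ i → ≡⇒≡ₘ (≡.cong ⟨_⟩ (toℕ-scaling ua i))) ⟨
    ∏ {p} (λ i → ⟨ toℕ (scaling ua ⟨$⟩ʳ i) ⟩)  ≈⟨ ∏-permute (λ i → ⟨ toℕ i ⟩) (scaling ua) ⟨
    P                                         ≡⟨ ℕP.*-identityˡ P ⟨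
    1 * P                                     ∎)
    where
    ⟨_⟩ : ℕ → ℕ
    ⟨ zero ⟩  = 1
    ⟨ suc x ⟩ = suc x
    weight : ℕ → ℕ
    weight zero    = 1
    weight (suc _) = a
    P = ∏ {p} (λ i → ⟨ toℕ i ⟩)
    ⟨⟩-unit : ∀ x → x < p → Unit ⟨ x ⟩
    ⟨⟩-unit zero    _   = unit-1
    ⟨⟩-unit (suc x) x<p = nonzero⇒unit x<p λ ()
    ⟨a*⟩ : ∀ x → x < p → ⟨ (a * x) % p ⟩ ≡ₘ weight x * ⟨ x ⟩
    ⟨a*⟩ zero    _   rewrite ℕP.*-zeroʳ a | 0%p = reflₘ
    ⟨a*⟩ (suc x) x<p with (a * suc x) % p in ax%p | unit-* ua (nonzero⇒unit x<p λ ())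
    ... | zero  | uax = ⊥-elim (uax ≡.refl)
    ... | suc _ | _   = ≡.trans (≡⇒≡ₘ (≡.sym ax%p)) (≡.trans (%-≡ₘ (a * suc x)) ax%p)
    ∏-weight : ∀ n → ∏ {n} (λ i → weight (toℕ i)) ≡ a ^ (n ∸ 1)
    ∏-weight zero    = ≡.refl
    ∏-weight (suc n) = ≡.trans (ℕP.*-identityˡ _) (∏-const n a)

  *-inverse : ∀ {a} → Unit a → a * a ^ (p ∸ 2) ≡ₘ 1
  *-inverse {a} ua = ≡.trans (≡⇒≡ₘ (≡.cong (a ^_) (≡.sym (ℕP.+-∸-assoc 1 1<p)))) (fermat ua)

  inverse-unique : ∀ {a b} → Unit a → a * b ≡ₘ 1 → b ≡ₘ a ^ (p ∸ 2)
  inverse-unique {a} {b} ua ab≡1 = *-cancelʳ-unit ua (begin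
    b * a            ≡⟨ ℕP.*-comm b a ⟩
    a * b            ≈⟨ ab≡1 ⟩
    1                ≈⟨ *-inverse ua ⟨
    a * a ^ (p ∸ 2)  ≡⟨ ℕP.*-comm a _ ⟩
    a ^ (p ∸ 2) * a  ∎)

  p∸1+1≡ₘ0 : ∀ x → (p ∸ 1) * x + x ≡ₘ 0
  p∸1+1≡ₘ0 x = begin
    (p ∸ 1) * x + x    ≡⟨ ℕP.+-comm ((p ∸ 1) * x) x ⟩
    (1 + (p ∸ 1)) * x  ≡⟨ ≡.cong (_* x) (ℕP.m+[n∸m]≡n (ℕP.<-trans ℕ.z<s 1<p)) ⟩
    p * x              ≡⟨ ℕP.*-comm p x ⟩
    x * p              ≈⟨ ≡.trans (m*n%n≡0 x p) (≡.sym 0%p) ⟩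
    0                  ∎

  [p∸1]*≡ₘ- : ∀ x → (p ∸ 1) * x ≡ₘ -ₘ x
  [p∸1]*≡ₘ- x = +-inverseʳ-unique x ((p ∸ 1) * x) (≡.trans (≡⇒≡ₘ (ℕP.+-comm x _)) (p∸1+1≡ₘ0 x))

  ≢ₘ1⇒unit : ∀ {a} → ¬ a ≡ₘ 1 → Unit (a + (p ∸ 1))
  ≢ₘ1⇒unit {a} a≢1 a-1≡0 = a≢1 (x∙y⁻¹≈ε⇒x≈y a 1 (begin
    a + -ₘ 1          ≈⟨ +-congₘ {a} reflₘ ([p∸1]*≡ₘ- 1) ⟨
    a + (p ∸ 1) * 1   ≡⟨ ≡.cong (a +_) (ℕP.*-identityʳ (p ∸ 1)) ⟩
    a + (p ∸ 1)       ≈⟨ ≡.trans a-1≡0 (≡.sym 0%p) ⟩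
    0                 ∎))

  -- As p ∸ 1 represents −1, this is the norm form a² − εb² of 𝔽_p[√ε], anisotropic for a non-residue ε.
  norm-unit : ∀ {ε a b} → ¬ (∃ λ x → x * x ≡ₘ ε) → Unit a ⊎ Unit b →
              Unit (a * a + (p ∸ 1) * ε * b * b)
  norm-unit {ε} {a} {b} nonsquare units with b % p ℕ.≟ 0
  ... | no ub = λ N≡0 → nonsquare (a * b′ , +-cancelʳ ((p ∸ 1) * ε) (a * b′ * (a * b′)) ε (begin
      a * b′ * (a * b′) + (p ∸ 1) * ε                        ≈⟨ +-congₘ {a * b′ * (a * b′)} reflₘ (symₘ ε[bb′]²≡ε) ⟩
      a * b′ * (a * b′) + (p ∸ 1) * ε * (b * b′) * (b * b′)  ≡⟨ rearrange a b b′ ((p ∸ 1) * ε) ⟩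
      (a * a + (p ∸ 1) * ε * b * b) * (b′ * b′)              ≈⟨ *-congₘ {_} {0} {b′ * b′} (≡.trans N≡0 (≡.sym 0%p)) reflₘ ⟩
      0                                                      ≈⟨ p∸1+1≡ₘ0 ε ⟨
      (p ∸ 1) * ε + ε                                        ≡⟨ ℕP.+-comm _ ε ⟩
      ε + (p ∸ 1) * ε                                        ∎))
    where
    b′ = proj₁ (unit⇒invertible ub)
    bb′≡1 = proj₂ (unit⇒invertible ub)
    ε[bb′]²≡ε : (p ∸ 1) * ε * (b * b′) * (b * b′) ≡ₘ (p ∸ 1) * ε
    ε[bb′]²≡ε = ≡.trans (*-congₘ {(p ∸ 1) * ε * (b * b′)} (*-congₘ {(p ∸ 1) * ε} reflₘ bb′≡1) bb′≡1)
                        (≡⇒≡ₘ (≡.trans (ℕP.*-identityʳ _) (ℕP.*-identityʳ _)))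
    rearrange : ∀ a b b′ c → a * b′ * (a * b′) + c * (b * b′) * (b * b′) ≡ (a * a + c * b * b) * (b′ * b′)
    rearrange = solve-∀
  ... | yes b≡0 = λ N≡0 → [ (λ ua → unit-* ua ua (≡.trans (≡.sym N≡a²) N≡0)) , (λ ub → ub b≡0) ] units
    where
    N≡a² : a * a + (p ∸ 1) * ε * b * b ≡ₘ a * a
    N≡a² = begin
      a * a + (p ∸ 1) * ε * b * b  ≈⟨ +-congₘ {a * a} reflₘ (*-congₘ {(p ∸ 1) * ε * b} (*-congₘ {(p ∸ 1) * ε} reflₘ b≡0′) b≡0′) ⟩
      a * a + (p ∸ 1) * ε * 0 * 0  ≡⟨ ≡.cong (a * a +_) (ℕP.*-zeroʳ ((p ∸ 1) * ε * 0)) ⟩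
      a * a + 0                    ≡⟨ ℕP.+-identityʳ _ ⟩
      a * a                        ∎
      where
      b≡0′ : b ≡ₘ 0
      b≡0′ = ≡.trans b≡0 (≡.sym 0%p)

module HhatIdentity {c ℓ : Level} (R : CommutativeRing c ℓ) (p : ℕ) (pp : Prime p)
                 (ε : ℕ) (ζ γ' pinv : CommutativeRing.Carrier R)
                 (ξ : ℕ × ℕ → CommutativeRing.Carrier R) where

  open Setting R p pp ε ζ γ' pinv ξ
  open PrimeResidues p pp hiding (p-nonZero)

  module Congruences where
    open ≡ₘ-Reasoning
    open import Data.Nat using (_+_; _*_; _∸_)

    *-inv : ∀ {a} → Unit a → a * inv a ≡ₘ 1
    *-inv {a} ua = ≡.trans (*-congₘ {a} ≡.refl (%-≡ₘ _)) (*-inverse ua)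

    inv-unit : ∀ {a} → Unit a → Unit (inv a)
    inv-unit {a} ua = invertible⇒unit {a} (*-inv ua)

    +-neg : ∀ a → a + neg a ≡ₘ 0
    +-neg a = ≡.trans (+-congₘ {a} ≡.refl (%-≡ₘ (-ₘ a))) (+-inverseʳₘ a)

    inv-unique : ∀ {a b} → Unit a → a * b ≡ₘ 1 → b ≡ₘ inv a
    inv-unique ua ab≡1 = ≡.trans (inverse-unique ua ab≡1) (≡.sym (%-≡ₘ _))

    *-inv-% : ∀ {a} → Unit a → a * inv (a % p) ≡ₘ 1
    *-inv-% {a} ua = ≡.trans (*-congₘ {a} (≡.sym (%-≡ₘ a)) ≡.refl) (*-inv (unit-cong (≡.sym (%-≡ₘ a)) ua))

    inv-% : ∀ {m x} → Unit m → Unit x → m * inv ((m * x) % p) ≡ₘ inv x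
    inv-% {m} {x} um ux = begin
      m * inv ((m * x) % p)        ≈⟨ *-congₘ {m} ≡.refl (inv-unique (unit-cong (≡.sym (%-≡ₘ (m * x))) (unit-* um ux)) mx[m̄x̄]≡1) ⟨
      m * (inv m * inv x)          ≡⟨ ℕP.*-assoc m (inv m) (inv x) ⟨
      m * inv m * inv x            ≈⟨ *-congₘ {m * inv m} (*-inv um) ≡.refl ⟩
      1 * inv x                    ≡⟨ ℕP.*-identityˡ (inv x) ⟩
      inv x                        ∎
      where
      mx[m̄x̄]≡1 : (m * x) % p * (inv m * inv x) ≡ₘ 1
      mx[m̄x̄]≡1 = begin
        (m * x) % p * (inv m * inv x)    ≈⟨ *-congₘ {(m * x) % p} (%-≡ₘ (m * x)) ≡.refl ⟩
        m * x * (inv m * inv x)          ≡⟨ interchange m x (inv m) (inv x) ⟩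
        m * inv m * (x * inv x)          ≈⟨ *-congₘ {m * inv m} (*-inv um) (*-inv ux) ⟩
        1                                ∎
        where
        interchange : ∀ a b c d → a * b * (c * d) ≡ a * c * (b * d)
        interchange = solve-∀

    inv-*-solution : ∀ {u x₁ x₂} n → Unit u → Unit x₁ → Unit x₂ →
                     inv u * x₁ * x₂ * (u * (n * inv x₁ * inv x₂)) ≡ₘ n
    inv-*-solution {u} {x₁} {x₂} n uu ux₁ ux₂ = begin
      inv u * x₁ * x₂ * (u * (n * inv x₁ * inv x₂))       ≡⟨ regroup (inv u) x₁ x₂ u n (inv x₁) (inv x₂) ⟩
      u * inv u * (x₁ * inv x₁) * (x₂ * inv x₂) * n       ≈⟨ *-congₘ {u * inv u * (x₁ * inv x₁) * (x₂ * inv x₂)} {1} {n}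
                                                               (*-congₘ {u * inv u * (x₁ * inv x₁)} {1}
                                                                 (*-congₘ {u * inv u} (*-inv uu) (*-inv ux₁)) (*-inv ux₂)) ≡.refl ⟩
      1 * n                                               ≡⟨ ℕP.*-identityˡ n ⟩
      n                                                   ∎
      where
      regroup : ∀ ū x₁ x₂ u n x̄₁ x̄₂ → ū * x₁ * x₂ * (u * (n * x̄₁ * x̄₂)) ≡ u * ū * (x₁ * x̄₁) * (x₂ * x̄₂) * n
      regroup = solve-∀

    inv-*-unique : ∀ {u x₁ x₂ x₃} n → Unit u → Unit x₁ → Unit x₂ →
                   inv u * x₁ * x₂ * x₃ ≡ₘ n → x₃ ≡ₘ u * (n * inv x₁ * inv x₂)
    inv-*-unique {u} {x₁} {x₂} {x₃} n uu ux₁ ux₂ ūx₁x₂x₃≡n =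
      *-cancelʳ-unit (unit-* (unit-* (inv-unit uu) ux₁) ux₂) (begin
        x₃ * (inv u * x₁ * x₂)                          ≡⟨ ℕP.*-comm x₃ _ ⟩
        inv u * x₁ * x₂ * x₃                            ≈⟨ ūx₁x₂x₃≡n ⟩
        n                                               ≈⟨ inv-*-solution n uu ux₁ ux₂ ⟨
        inv u * x₁ * x₂ * (u * (n * inv x₁ * inv x₂))   ≡⟨ ℕP.*-comm (inv u * x₁ * x₂) _ ⟩
        u * (n * inv x₁ * inv x₂) * (inv u * x₁ * x₂)   ∎)

    isZeroL-false : ∀ {t} → isZeroL t ≡ false → Unit (proj₁ t) ⊎ Unit (proj₂ t)
    isZeroL-false {a , b} t≢0 with a % p ℕ.≟ 0 | b % p ℕ.≟ 0
    ... | no a≢0  | _       = inj₁ a≢0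
    ... | yes _   | no b≢0  = inj₂ b≢0

    Nm-isZeroL : ∀ {t} → isZeroL t ≡ true → Nm t ≡ 0
    Nm-isZeroL {a , b} t≡0 with a % p ℕ.≟ 0 | b % p ℕ.≟ 0
    ... | yes a≡0 | yes b≡0 = ≡.trans (begin
      a * a + (p ∸ 1) * ε * b * b  ≈⟨ +-congₘ (*-congₘ a≡0′ a≡0′) (*-congₘ {(p ∸ 1) * ε * b} (*-congₘ {(p ∸ 1) * ε} ≡.refl b≡0′) b≡0′) ⟩
      0 * 0 + (p ∸ 1) * ε * 0 * 0  ≡⟨ ℕP.*-zeroʳ ((p ∸ 1) * ε * 0) ⟩
      0                            ∎) 0%p
      where
      a≡0′ = ≡.trans a≡0 (≡.sym 0%p)
      b≡0′ = ≡.trans b≡0 (≡.sym 0%p)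

    Nm-unit : ¬ (∃ λ x → x * x ≡ₘ ε) → ∀ {t} → isZeroL t ≡ false → Unit (Nm t)
    Nm-unit nonsquare {a , b} t≢0 = unit-cong (≡.sym (%-≡ₘ _)) (norm-unit nonsquare (isZeroL-false t≢0))

    *-+-neg : ∀ u c → u * c + neg u ≡ₘ (c + (p ∸ 1)) * u
    *-+-neg u c = begin
      u * c + neg u            ≈⟨ +-congₘ {u * c} ≡.refl (≡.trans (%-≡ₘ (-ₘ u)) (≡.sym ([p∸1]*≡ₘ- u))) ⟩
      u * c + (p ∸ 1) * u      ≡⟨ ≡.cong (_+ (p ∸ 1) * u) (ℕP.*-comm u c) ⟩
      c * u + (p ∸ 1) * u      ≡⟨ ℕP.*-distribʳ-+ u c (p ∸ 1) ⟨
      (c + (p ∸ 1)) * u        ∎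

  open Congruences
  open CommutativeRing R
  open RingProperties ring using (-‿distribʳ-*; -‿involutive; +-inverseʳ-unique; -1*x≈-x; -0#≈0#; x≈z//y)
  open CommSemigroupProperties *-commutativeSemigroup using (x∙yz≈y∙xz)
  open SetoidReasoning setoid
  open MonoidSum +-commutativeMonoid using (sum; sum-cong-≋; ∑-distrib-+; ∑-comm; sum-permute)
  open SemiringSum semiring using (*-distribˡ-sum)
  module ℛ = NatCoeffSolver commutativeSemiring

  pow-+ : ∀ x m n → pow x (m ℕ.+ n) ≈ pow x m * pow x n
  pow-+ x zero    n = sym (*-identityˡ _)
  pow-+ x (suc m) n = trans (*-congˡ (pow-+ x m n)) (sym (*-assoc _ _ _))

  *-affine : ∀ a b c → a * (b * c - 1#) ≈ b * (a * c) - a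
  *-affine a b c = begin
    a * (b * c - 1#)        ≈⟨ distribˡ a (b * c) (- 1#) ⟩
    a * (b * c) + a * - 1#  ≈⟨ +-cong (x∙yz≈y∙xz b a c) (-‿distribʳ-* a 1#) ⟨
    b * (a * c) - a * 1#    ≈⟨ +-congˡ (-‿cong (*-identityʳ a)) ⟩
    b * (a * c) - a         ∎

  cancel-scalars : ∀ {g g′ x y} z → g * g′ ≈ 1# → x * y ≈ 1# → g * pow x 2 * (y * y * (g′ * z)) ≈ z
  cancel-scalars {g} {g′} {x} {y} z gg′≈1 xy≈1 = begin
    g * pow x 2 * (y * y * (g′ * z))     ≈⟨ regroup g g′ x y z ⟩
    g * g′ * (x * y) * (x * y) * z       ≈⟨ *-congʳ (*-cong (*-cong gg′≈1 xy≈1) xy≈1) ⟩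
    1# * 1# * 1# * z                     ≈⟨ trans (*-congʳ (trans (*-identityʳ _) (*-identityʳ _))) (*-identityˡ z) ⟩
    z                                    ∎
    where
    regroup : ∀ g g′ x y z → g * pow x 2 * (y * y * (g′ * z)) ≈ g * g′ * (x * y) * (x * y) * z
    regroup = ℛ.solve 5 (λ g g′ x y z → g ℛ.:* (x ℛ.:* (x ℛ.:* ℛ.con 1)) ℛ.:* (y ℛ.:* y ℛ.:* (g′ ℛ.:* z))
                                        ℛ.:= g ℛ.:* g′ ℛ.:* (x ℛ.:* y) ℛ.:* (x ℛ.:* y) ℛ.:* z) refl

  Σ≡sum : ∀ n (f : Fin n → Carrier) → Σ[ n ] f ≡ sum f
  Σ≡sum zero    f = ≡.refl
  Σ≡sum (suc n) f = ≡.cong (f Fin.zero +_) (Σ≡sum n (λ i → f (Fin.suc i)))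

  Σ-cong : ∀ n {f g : Fin n → Carrier} → (∀ i → f i ≈ g i) → Σ[ n ] f ≈ Σ[ n ] g
  Σ-cong n {f} {g} f≈g = begin
    Σ[ n ] f  ≡⟨ Σ≡sum n f ⟩
    sum f     ≈⟨ sum-cong-≋ f≈g ⟩
    sum g     ≡⟨ Σ≡sum n g ⟨
    Σ[ n ] g  ∎

  Σ-+ : ∀ n (f g : Fin n → Carrier) → Σ[ n ] (λ i → f i + g i) ≈ Σ[ n ] f + Σ[ n ] g
  Σ-+ n f g = begin
    Σ[ n ] (λ i → f i + g i)  ≡⟨ Σ≡sum n _ ⟩
    sum (λ i → f i + g i)     ≈⟨ ∑-distrib-+ f g ⟩
    sum f + sum g             ≡⟨ ≡.cong₂ _+_ (Σ≡sum n f) (Σ≡sum n g) ⟨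
    Σ[ n ] f + Σ[ n ] g       ∎

  Σ-*ˡ : ∀ n x (f : Fin n → Carrier) → Σ[ n ] (λ i → x * f i) ≈ x * Σ[ n ] f
  Σ-*ˡ n x f = begin
    Σ[ n ] (λ i → x * f i)  ≡⟨ Σ≡sum n _ ⟩
    sum (λ i → x * f i)     ≈⟨ *-distribˡ-sum x f ⟨
    x * sum f               ≡⟨ ≡.cong (x *_) (Σ≡sum n f) ⟨
    x * Σ[ n ] f            ∎

  Σ-neg : ∀ n (f : Fin n → Carrier) → Σ[ n ] (λ i → - f i) ≈ - Σ[ n ] f
  Σ-neg n f = begin
    Σ[ n ] (λ i → - f i)  ≡⟨ Σ≡sum n _ ⟩
    sum (λ i → - f i)     ≈⟨ sum-⁻¹ +-abelianGroup f ⟩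
    - sum f               ≡⟨ ≡.cong -_ (Σ≡sum n f) ⟨
    - Σ[ n ] f            ∎

  Σ-comm : ∀ m n (f : Fin m → Fin n → Carrier) →
           Σ[ m ] (λ i → Σ[ n ] (λ j → f i j)) ≈ Σ[ n ] (λ j → Σ[ m ] (λ i → f i j))
  Σ-comm m n f = begin
    Σ[ m ] (λ i → Σ[ n ] (λ j → f i j))  ≈⟨ Σ-cong m (λ i → reflexive (Σ≡sum n (f i))) ⟩
    Σ[ m ] (λ i → sum (λ j → f i j))     ≡⟨ Σ≡sum m _ ⟩
    sum (λ i → sum (λ j → f i j))        ≈⟨ ∑-comm f ⟩
    sum (λ j → sum (λ i → f i j))        ≡⟨ Σ≡sum n _ ⟨
    Σ[ n ] (λ j → sum (λ i → f i j))     ≈⟨ Σ-cong n (λ j → reflexive (Σ≡sum m (λ i → f i j))) ⟨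
    Σ[ n ] (λ j → Σ[ m ] (λ i → f i j))  ∎

  Σ-permute : ∀ n (f : Fin n → Carrier) (π : Permutation n n) → Σ[ n ] f ≈ Σ[ n ] (λ i → f (π ⟨$⟩ʳ i))
  Σ-permute n f π = begin
    Σ[ n ] f                      ≡⟨ Σ≡sum n f ⟩
    sum f                         ≈⟨ sum-permute f π ⟩
    sum (λ i → f (π ⟨$⟩ʳ i))      ≡⟨ Σ≡sum n _ ⟨
    Σ[ n ] (λ i → f (π ⟨$⟩ʳ i))   ∎

  Σ-single : ∀ n (f : Fin n → Carrier) j → (∀ i → ¬ i ≡ j → f i ≈ 0#) → Σ[ n ] f ≈ f j
  Σ-single n f j f≈0 = trans (reflexive (Σ≡sum n f)) (sum-single +-commutativeMonoid f j f≈0)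

  Σ-lin : ∀ n a (f g : Fin n → Carrier) → Σ[ n ] (λ i → a * f i - g i) ≈ a * Σ[ n ] f - Σ[ n ] g
  Σ-lin n a f g = trans (Σ-+ n _ _) (+-cong (Σ-*ˡ n a f) (Σ-neg n g))

  Σ-zero : ∀ n {f : Fin n → Carrier} → (∀ i → f i ≈ 0#) → Σ[ n ] f ≈ 0#
  Σ-zero zero    f≈0 = refl
  Σ-zero (suc n) f≈0 = trans (+-cong (f≈0 Fin.zero) (Σ-zero n (λ i → f≈0 (Fin.suc i)))) (+-identityʳ 0#)

  Σ-one : ∀ n → Σ[ n ] (λ _ → 1#) ≈ ι n
  Σ-one zero    = refl
  Σ-one (suc n) = +-congˡ (Σ-one n)

  onUnits : (ℕ → Carrier) → ℕ → Carrier
  onUnits f x = if ⌊ x ℕ.≟ 0 ⌋ then 0# else f x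

  onUnits-cong : ∀ {f g : ℕ → Carrier} x → (¬ x ≡ 0 → f x ≈ g x) → onUnits f x ≈ onUnits g x
  onUnits-cong x f≈g with x ℕ.≟ 0
  ... | yes _   = refl
  ... | no x≢0  = f≈g x≢0

  onUnits-zero : ∀ {f : ℕ → Carrier} x → (¬ x ≡ 0 → f x ≈ 0#) → onUnits f x ≈ 0#
  onUnits-zero x f≈0 with x ℕ.≟ 0
  ... | yes _   = refl
  ... | no x≢0  = f≈0 x≢0

  ΣU-cong : ∀ {f g : ℕ → Carrier} → (∀ x → Unit x → f x ≈ g x) → ΣU f ≈ ΣU g
  ΣU-cong {f} {g} f≈g =
    Σ-cong p λ i → onUnits-cong {f} {g} (toℕ i) (λ i≢0 → f≈g (toℕ i) (nonzero⇒unit (toℕ<n i) i≢0))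

  ΣU-zero : ∀ {f : ℕ → Carrier} → (∀ x → Unit x → f x ≈ 0#) → ΣU f ≈ 0#
  ΣU-zero {f} f≈0 =
    Σ-zero p λ i → onUnits-zero {f} (toℕ i) (λ i≢0 → f≈0 (toℕ i) (nonzero⇒unit (toℕ<n i) i≢0))

  ΣU-*ˡ : ∀ a (f : ℕ → Carrier) → ΣU (λ x → a * f x) ≈ a * ΣU f
  ΣU-*ˡ a f = trans (Σ-cong p (λ i → split (toℕ i))) (Σ-*ˡ p a _)
    where
    split : ∀ x → onUnits (λ y → a * f y) x ≈ a * onUnits f x
    split x with x ℕ.≟ 0
    ... | yes _ = sym (zeroʳ a)
    ... | no _  = refl

  ΣU-lin : ∀ a (f g : ℕ → Carrier) → ΣU (λ x → a * f x - g x) ≈ a * ΣU f - ΣU g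
  ΣU-lin a f g = trans (Σ-cong p (λ i → split (toℕ i))) (Σ-lin p a _ _)
    where
    split : ∀ x → onUnits (λ y → a * f y - g y) x ≈ a * onUnits f x - onUnits g x
    split x with x ℕ.≟ 0
    ... | yes _ = sym (trans (+-cong (zeroʳ a) -0#≈0#) (+-identityʳ 0#))
    ... | no _  = refl

  Σ-split₀ : ∀ (f : ℕ → Carrier) → Σ[ p ] (λ i → f (toℕ i)) ≈ f 0 + ΣU f
  Σ-split₀ f = split p (ℕP.<-trans ℕ.z<s 1<p)
    where
    split : ∀ n → 0 < n → Σ[ n ] (λ i → f (toℕ i)) ≈ f 0 + Σ[ n ] (λ i → onUnits f (toℕ i))
    split (suc n) _ = +-congˡ (sym (+-identityˡ _))

  Σ≈ΣU : ∀ (f : ℕ → Carrier) {g} → f 0 ≈ 0# → (∀ x → Unit x → f x ≈ g x) → Σ[ p ] (λ i → f (toℕ i)) ≈ ΣU g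
  Σ≈ΣU f {g} f0≈0 f≈g = begin
    Σ[ p ] (λ i → f (toℕ i))  ≈⟨ Σ-split₀ f ⟩
    f 0 + ΣU f               ≈⟨ +-cong f0≈0 (ΣU-cong f≈g) ⟩
    0# + ΣU g                ≈⟨ +-identityˡ _ ⟩
    ΣU g                     ∎

  ΣU-comm : ∀ (f : ℕ → ℕ → Carrier) → ΣU (λ x → ΣU (λ y → f x y)) ≈ ΣU (λ y → ΣU (λ x → f x y))
  ΣU-comm f = begin
    ΣU (λ x → ΣU (λ y → f x y))                                       ≈⟨ Σ-cong p (λ i → expand (toℕ i)) ⟩
    Σ[ p ] (λ i → Σ[ p ] (λ j → onUnits (λ x → onUnits (f x) (toℕ j)) (toℕ i)))  ≈⟨ Σ-comm p p _ ⟩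
    Σ[ p ] (λ j → Σ[ p ] (λ i → onUnits (λ x → onUnits (f x) (toℕ j)) (toℕ i)))  ≈⟨ Σ-cong p (λ j → collapse (toℕ j)) ⟩
    ΣU (λ y → ΣU (λ x → f x y))                                       ∎
    where
    expand : ∀ x → onUnits (λ x → ΣU (f x)) x ≈ Σ[ p ] (λ j → onUnits (λ x → onUnits (f x) (toℕ j)) x)
    expand x with x ℕ.≟ 0
    ... | yes _ = sym (Σ-zero p (λ _ → refl))
    ... | no _  = refl
    collapse : ∀ y → Σ[ p ] (λ i → onUnits (λ x → onUnits (f x) y) (toℕ i)) ≈ onUnits (λ y → ΣU (λ x → f x y)) y
    collapse y with y ℕ.≟ 0
    ... | yes _ = Σ-zero p (λ i → onUnits-zero (toℕ i) (λ _ → refl))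
    ... | no _  = refl

  Σ-residue-single : ∀ (f : ℕ → Carrier) w → (∀ x → x < p → ¬ x ≡ₘ w → f x ≈ 0#) →
                     Σ[ p ] (λ i → f (toℕ i)) ≈ f (w % p)
  Σ-residue-single f w f≈0 = begin
    Σ[ p ] (λ i → f (toℕ i))  ≈⟨ Σ-single p _ (residue w)
                                    (λ i i≢w → f≈0 (toℕ i) (toℕ<n i) (i≢w ∘ ≡.sym ∘ residue-unique ∘ ≡.sym)) ⟩
    f (toℕ (residue w))       ≡⟨ ≡.cong f (toℕ-residue w) ⟩
    f (w % p)                 ∎

  ΣU-single : ∀ (f : ℕ → Carrier) {w} → Unit w → (∀ x → Unit x → ¬ x ≡ₘ w → f x ≈ 0#) → ΣU f ≈ f (w % p)
  ΣU-single f {w} uw f≈0 = begin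
    ΣU f                 ≈⟨ Σ-residue-single (onUnits f) w
                              (λ x x<p x≢w → onUnits-zero {f} x (λ x≢0 → f≈0 x (nonzero⇒unit x<p x≢0) x≢w)) ⟩
    onUnits f (w % p)    ≡⟨ if-no uw ⟩
    f (w % p)            ∎

  ΣU-scale : ∀ (f : ℕ → Carrier) {a} → Unit a → ΣU f ≈ ΣU (λ x → f ((a ℕ.* x) % p))
  ΣU-scale f {a} ua = begin
    ΣU f                                                ≈⟨ Σ-permute p _ (scaling ua) ⟩
    Σ[ p ] (λ i → onUnits f (toℕ (scaling ua ⟨$⟩ʳ i)))  ≈⟨ Σ-cong p (λ i → scaled (toℕ i) (toℕ<n i) (toℕ-scaling ua i)) ⟩
    ΣU (λ x → f ((a ℕ.* x) % p))                        ∎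
    where
    scaled : ∀ x {y} → x < p → y ≡ (a ℕ.* x) % p → onUnits f y ≈ onUnits (λ x → f ((a ℕ.* x) % p)) x
    scaled zero    _   ≡.refl = reflexive (if-yes (≡.trans (≡.cong (_% p) (ℕP.*-zeroʳ a)) 0%p))
    scaled (suc x) x<p ≡.refl = reflexive (if-no (unit-* ua (nonzero⇒unit x<p λ ())))

  ΣL-cong : ∀ {f g : OL → Carrier} → (∀ t → f t ≈ g t) → ΣL f ≈ ΣL g
  ΣL-cong f≈g = Σ-cong p λ a → Σ-cong p λ b → f≈g _

  ΣL-zero : ∀ {f : OL → Carrier} → (∀ t → f t ≈ 0#) → ΣL f ≈ 0#
  ΣL-zero f≈0 = Σ-zero p λ a → Σ-zero p λ b → f≈0 _

  ΣL-*ˡ : ∀ x (f : OL → Carrier) → ΣL (λ t → x * f t) ≈ x * ΣL f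
  ΣL-*ˡ x f = trans (Σ-cong p λ a → Σ-*ˡ p x _) (Σ-*ˡ p x _)

  ΣL-lin : ∀ x (f g : OL → Carrier) → ΣL (λ t → x * f t - g t) ≈ x * ΣL f - ΣL g
  ΣL-lin x f g = begin
    ΣL (λ t → x * f t - g t)                                                          ≈⟨ Σ-cong p (λ a → Σ-lin p x _ _) ⟩
    Σ[ p ] (λ a → x * Σ[ p ] (λ b → f (toℕ a , toℕ b)) - Σ[ p ] (λ b → g (toℕ a , toℕ b)))  ≈⟨ Σ-lin p x _ _ ⟩
    x * ΣL f - ΣL g                                                                   ∎

  Σ-ΣL-comm : ∀ n (f : Fin n → OL → Carrier) → Σ[ n ] (λ i → ΣL (f i)) ≈ ΣL (λ t → Σ[ n ] (λ i → f i t))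
  Σ-ΣL-comm n f = trans (Σ-comm n p _) (Σ-cong p λ a → Σ-comm n p _)

  ΣU-ΣL-comm : ∀ (f : ℕ → OL → Carrier) → ΣU (λ y → ΣL (f y)) ≈ ΣL (λ t → ΣU (λ y → f y t))
  ΣU-ΣL-comm f = trans (Σ-cong p (λ i → onUnits-ΣL (toℕ i))) (Σ-ΣL-comm p λ i t → onUnits (λ y → f y t) (toℕ i))
    where
    onUnits-ΣL : ∀ y → onUnits (λ y → ΣL (f y)) y ≈ ΣL (λ t → onUnits (λ y → f y t) y)
    onUnits-ΣL y with y ℕ.≟ 0
    ... | yes _ = sym (ΣL-zero λ _ → refl)
    ... | no _  = refl

  Σ⁴ : (ℕ → ℕ → ℕ → ℕ → Carrier) → Carrier
  Σ⁴ f = Σ[ p ] λ u → Σ[ p ] λ x₁ → Σ[ p ] λ x₂ → Σ[ p ] λ x₃ → f (toℕ u) (toℕ x₁) (toℕ x₂) (toℕ x₃)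

  Σ⁴-cong : ∀ {f g : ℕ → ℕ → ℕ → ℕ → Carrier} → (∀ u x₁ x₂ x₃ → f u x₁ x₂ x₃ ≈ g u x₁ x₂ x₃) → Σ⁴ f ≈ Σ⁴ g
  Σ⁴-cong f≈g = Σ-cong p λ u → Σ-cong p λ x₁ → Σ-cong p λ x₂ → Σ-cong p λ x₃ → f≈g _ _ _ _

  Σ⁴-zero : ∀ {f : ℕ → ℕ → ℕ → ℕ → Carrier} → (∀ u x₁ x₂ x₃ → f u x₁ x₂ x₃ ≈ 0#) → Σ⁴ f ≈ 0#
  Σ⁴-zero f≈0 = Σ-zero p λ u → Σ-zero p λ x₁ → Σ-zero p λ x₂ → Σ-zero p λ x₃ → f≈0 _ _ _ _

  Σ⁴-*ˡ : ∀ a (f : ℕ → ℕ → ℕ → ℕ → Carrier) → Σ⁴ (λ u x₁ x₂ x₃ → a * f u x₁ x₂ x₃) ≈ a * Σ⁴ f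
  Σ⁴-*ˡ a f = trans (Σ-cong p λ u → trans (Σ-cong p λ x₁ → trans (Σ-cong p λ x₂ → Σ-*ˡ p a _) (Σ-*ˡ p a _)) (Σ-*ˡ p a _))
                    (Σ-*ˡ p a _)

  Σ⁴-ΣL-comm : ∀ (f : ℕ → ℕ → ℕ → ℕ → OL → Carrier) →
               Σ⁴ (λ u x₁ x₂ x₃ → ΣL (f u x₁ x₂ x₃)) ≈ ΣL (λ t → Σ⁴ (λ u x₁ x₂ x₃ → f u x₁ x₂ x₃ t))
  Σ⁴-ΣL-comm f =
    trans (Σ-cong p λ u → Σ-cong p λ x₁ → Σ-cong p λ x₂ → Σ-ΣL-comm p λ x₃ → F u x₁ x₂ x₃)
    (trans (Σ-cong p λ u → Σ-cong p λ x₁ → Σ-ΣL-comm p λ x₂ t → Σ[ p ] λ x₃ → F u x₁ x₂ x₃ t)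
    (trans (Σ-cong p λ u → Σ-ΣL-comm p λ x₁ t → Σ[ p ] λ x₂ → Σ[ p ] λ x₃ → F u x₁ x₂ x₃ t)
    (Σ-ΣL-comm p λ u t → Σ[ p ] λ x₁ → Σ[ p ] λ x₂ → Σ[ p ] λ x₃ → F u x₁ x₂ x₃ t)))
    where
    F : Fin p → Fin p → Fin p → Fin p → OL → Carrier
    F u x₁ x₂ x₃ = f (toℕ u) (toℕ x₁) (toℕ x₂) (toℕ x₃)

  ΣU-one : ΣU (λ _ → 1#) ≈ ι p - 1#
  ΣU-one = x≈z//y (ΣU (λ _ → 1#)) 1# (ι p) (begin
    ΣU (λ _ → 1#) + 1#         ≈⟨ +-comm _ 1# ⟩
    1# + ΣU (λ _ → 1#)         ≈⟨ Σ-split₀ (λ _ → 1#) ⟨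
    Σ[ p ] (λ _ → 1#)          ≈⟨ Σ-one p ⟩
    ι p                        ∎)

  𝟙[_≡ₘ_] : ℕ → ℕ → Carrier
  𝟙[ a ≡ₘ b ] = if ⌊ a ≟ₘ b ⌋ then 1# else 0#

  module AdditiveCharacter (prim : PrimRoot) where

    pow-ζ-multiple : ∀ k → pow ζ (k ℕ.* p) ≈ 1#
    pow-ζ-multiple zero    = refl
    pow-ζ-multiple (suc k) = trans (pow-+ ζ p (k ℕ.* p)) (trans (*-cong (proj₁ prim) (pow-ζ-multiple k)) (*-identityˡ 1#))

    pow-ζ≈e : ∀ n → pow ζ n ≈ e n
    pow-ζ≈e n = begin
      pow ζ n                                ≡⟨ ≡.cong (pow ζ) (m≡m%n+[m/n]*n n p) ⟩
      pow ζ (n % p ℕ.+ n / p ℕ.* p)          ≈⟨ pow-+ ζ (n % p) _ ⟩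
      pow ζ (n % p) * pow ζ (n / p ℕ.* p)    ≈⟨ *-congˡ (pow-ζ-multiple (n / p)) ⟩
      pow ζ (n % p) * 1#                     ≈⟨ *-identityʳ _ ⟩
      e n                                    ∎

    e-+ : ∀ a b → e (a ℕ.+ b) ≈ e a * e b
    e-+ a b = begin
      e (a ℕ.+ b)          ≈⟨ pow-ζ≈e (a ℕ.+ b) ⟨
      pow ζ (a ℕ.+ b)      ≈⟨ pow-+ ζ a b ⟩
      pow ζ a * pow ζ b    ≈⟨ *-cong (pow-ζ≈e a) (pow-ζ≈e b) ⟩
      e a * e b            ∎

    e-cong : ∀ {a b} → a ≡ₘ b → e a ≡ e b
    e-cong = ≡.cong (pow ζ)

    e-zero : ∀ {a} → a ≡ₘ 0 → e a ≈ 1#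
    e-zero a≡0 = reflexive (≡.cong (pow ζ) (≡.trans a≡0 0%p))

    ΣU-e : ΣU e ≈ - 1#
    ΣU-e = +-inverseʳ-unique 1# (ΣU e) (begin
      1# + ΣU e                 ≈⟨ +-congʳ (e-zero ≡.refl) ⟨
      e 0 + ΣU e                ≈⟨ Σ-split₀ e ⟨
      Σ[ p ] (λ i → e (toℕ i))  ≈⟨ Σ-cong p (λ i → reflexive (≡.cong (pow ζ) (toℕ%p i))) ⟩
      Σ[ p ] (λ i → pow ζ (toℕ i))  ≈⟨ proj₂ prim ⟩
      0#                        ∎)

    ΣU-e-scaled : ∀ {a} → Unit a → ΣU (λ u → e (a ℕ.* u)) ≈ - 1#
    ΣU-e-scaled {a} ua = begin
      ΣU (λ u → e (a ℕ.* u))        ≈⟨ ΣU-cong (λ u _ → reflexive (e-cong (≡.sym (%-≡ₘ (a ℕ.* u))))) ⟩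
      ΣU (λ u → e ((a ℕ.* u) % p))  ≈⟨ ΣU-scale e ua ⟨
      ΣU e                          ≈⟨ ΣU-e ⟩
      - 1#                          ∎

    orthogonality : ∀ c → ΣU (λ u → e (u ℕ.* c ℕ.+ neg u)) ≈ ι p * 𝟙[ c ≡ₘ 1 ] - 1#
    orthogonality c with c ≟ₘ 1
    ... | yes c≡1 = begin
      ΣU (λ u → e (u ℕ.* c ℕ.+ neg u))  ≈⟨ ΣU-cong (λ u _ → e-zero (exponent≡0 u)) ⟩
      ΣU (λ _ → 1#)                     ≈⟨ ΣU-one ⟩
      ι p - 1#                          ≈⟨ +-congʳ (*-identityʳ (ι p)) ⟨
      ι p * 1# - 1#                     ∎
      where
      exponent≡0 : ∀ u → u ℕ.* c ℕ.+ neg u ≡ₘ 0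
      exponent≡0 u = ≡.trans (+-congₘ (*-congₘ {u} ≡.refl c≡1) ≡.refl)
                             (≡.trans (≡⇒≡ₘ (≡.cong (ℕ._+ neg u) (ℕP.*-identityʳ u))) (+-neg u))
    ... | no c≢1 = begin
      ΣU (λ u → e (u ℕ.* c ℕ.+ neg u))            ≈⟨ ΣU-cong (λ u _ → reflexive (e-cong (*-+-neg u c))) ⟩
      ΣU (λ u → e ((c ℕ.+ (p ℕ.∸ 1)) ℕ.* u))     ≈⟨ ΣU-e-scaled (≢ₘ1⇒unit c≢1) ⟩
      - 1#                                        ≈⟨ +-identityˡ _ ⟨
      0# - 1#                                     ≈⟨ +-congʳ (zeroʳ (ι p)) ⟨
      ι p * 0# - 1#                               ∎

  -- twistedKl n = Σ_{u, x₁x₂x₃ = nu} e_p(x₁ + x₂ + x₃ − u) = Σ_u e_p(−u) Kl₃(nu), u ranging over units via ψ₀.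
  twistedKl-term : ℕ → ℕ → ℕ → ℕ → ℕ → Carrier
  twistedKl-term n u x₁ x₂ x₃ =
    if ⌊ n ℕ.≟ red (inv u ℕ.* x₁ ℕ.* x₂ ℕ.* x₃ ℕ.* 1) ⌋ then ψ₀ u * e (x₁ ℕ.+ x₂ ℕ.+ x₃ ℕ.+ neg u) else 0#

  twistedKl : ℕ → Carrier
  twistedKl n = Σ⁴ (twistedKl-term n)

  ratio : ℕ → ℕ → ℕ → ℕ
  ratio n x₁ x₂ = n ℕ.* inv x₁ ℕ.* inv x₂

  module TwistedKloosterman (prim : PrimRoot) {n} (n<p : n < p) (un : Unit n) where
    open AdditiveCharacter prim

    term-u≡0 : ∀ x₁ x₂ x₃ → twistedKl-term n 0 x₁ x₂ x₃ ≈ 0#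
    term-u≡0 x₁ x₂ x₃ with n ℕ.≟ red (inv 0 ℕ.* x₁ ℕ.* x₂ ℕ.* x₃ ℕ.* 1)
    ... | yes _ = trans (*-congʳ (reflexive (if-yes 0%p))) (zeroˡ _)
    ... | no _  = refl

    term-nonunit : ∀ {u x₁ x₂ x₃} → red (inv u ℕ.* x₁ ℕ.* x₂ ℕ.* x₃ ℕ.* 1) ≡ 0 → twistedKl-term n u x₁ x₂ x₃ ≈ 0#
    term-nonunit X≡0 = reflexive (if-no λ n≡X → un (≡.trans (≡.cong red (≡.trans n≡X X≡0)) 0%p))

    term-x₁≡0 : ∀ u x₂ x₃ → twistedKl-term n u 0 x₂ x₃ ≈ 0#
    term-x₁≡0 u x₂ x₃ = term-nonunit (≡.trans (≡.cong (λ y → red (y ℕ.* x₂ ℕ.* x₃ ℕ.* 1)) (ℕP.*-zeroʳ (inv u))) 0%p)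

    term-x₂≡0 : ∀ u x₁ x₃ → twistedKl-term n u x₁ 0 x₃ ≈ 0#
    term-x₂≡0 u x₁ x₃ = term-nonunit (≡.trans (≡.cong (λ y → red (y ℕ.* x₃ ℕ.* 1)) (ℕP.*-zeroʳ (inv u ℕ.* x₁))) 0%p)

    x₃-sum : ∀ {u x₁ x₂} → Unit u → Unit x₁ → Unit x₂ →
             Σ[ p ] (λ i → twistedKl-term n u x₁ x₂ (toℕ i)) ≈ e (x₁ ℕ.+ x₂) * e (u ℕ.* ratio n x₁ x₂ ℕ.+ neg u)
    x₃-sum {u} {x₁} {x₂} uu ux₁ ux₂ = begin
      Σ[ p ] (λ i → twistedKl-term n u x₁ x₂ (toℕ i))    ≈⟨ Σ-residue-single _ w off-solution ⟩
      twistedKl-term n u x₁ x₂ (w % p)                   ≡⟨ if-yes (≡.sym (≡.trans X≡ₘn (m<n⇒m%n≡m n<p))) ⟩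
      ψ₀ u * e (x₁ ℕ.+ x₂ ℕ.+ w % p ℕ.+ neg u)            ≈⟨ *-congʳ (reflexive (if-no uu)) ⟩
      1# * e (x₁ ℕ.+ x₂ ℕ.+ w % p ℕ.+ neg u)              ≈⟨ *-identityˡ _ ⟩
      e (x₁ ℕ.+ x₂ ℕ.+ w % p ℕ.+ neg u)                   ≡⟨ e-cong exponent ⟩
      e (x₁ ℕ.+ x₂ ℕ.+ (w ℕ.+ neg u))                     ≈⟨ e-+ (x₁ ℕ.+ x₂) _ ⟩
      e (x₁ ℕ.+ x₂) * e (w ℕ.+ neg u)                     ∎
      where
      w = u ℕ.* ratio n x₁ x₂
      X≡ₘn : inv u ℕ.* x₁ ℕ.* x₂ ℕ.* (w % p) ℕ.* 1 ≡ₘ n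
      X≡ₘn = ≡.trans (≡⇒≡ₘ (ℕP.*-identityʳ _))
               (≡.trans (*-congₘ {inv u ℕ.* x₁ ℕ.* x₂} ≡.refl (%-≡ₘ w)) (inv-*-solution n uu ux₁ ux₂))
      off-solution : ∀ x → x < p → ¬ x ≡ₘ w → twistedKl-term n u x₁ x₂ x ≈ 0#
      off-solution x _ x≢w = reflexive (if-no λ n≡X → x≢w (inv-*-unique n uu ux₁ ux₂
        (≡.trans (≡.sym (≡⇒≡ₘ (ℕP.*-identityʳ _))) (≡.trans (≡.sym (%-≡ₘ _)) (≡.sym (≡.cong red n≡X))))))
      exponent : x₁ ℕ.+ x₂ ℕ.+ w % p ℕ.+ neg u ≡ₘ x₁ ℕ.+ x₂ ℕ.+ (w ℕ.+ neg u)
      exponent = ≡.trans (+-congₘ (+-congₘ {x₁ ℕ.+ x₂} ≡.refl (%-≡ₘ w)) ≡.refl) (≡⇒≡ₘ (ℕP.+-assoc (x₁ ℕ.+ x₂) w (neg u)))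

    x₂-sum : ∀ {x₁} → Unit x₁ → ΣU (λ x₂ → e (x₁ ℕ.+ x₂) * 𝟙[ ratio n x₁ x₂ ≡ₘ 1 ]) ≈ e (x₁ ℕ.+ (n ℕ.* inv x₁) % p)
    x₂-sum {x₁} ux₁ = begin
      ΣU (λ x₂ → e (x₁ ℕ.+ x₂) * 𝟙[ ratio n x₁ x₂ ≡ₘ 1 ])  ≈⟨ ΣU-single _ uv off-solution ⟩
      e (x₁ ℕ.+ v % p) * 𝟙[ ratio n x₁ (v % p) ≡ₘ 1 ]      ≡⟨ ≡.cong (e (x₁ ℕ.+ v % p) *_) (if-yes (*-inv-% uv)) ⟩
      e (x₁ ℕ.+ v % p) * 1#                               ≈⟨ *-identityʳ _ ⟩
      e (x₁ ℕ.+ v % p)                                    ∎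
      where
      v = n ℕ.* inv x₁
      uv : Unit v
      uv = unit-* un (inv-unit ux₁)
      off-solution : ∀ x → Unit x → ¬ x ≡ₘ v → e (x₁ ℕ.+ x) * 𝟙[ ratio n x₁ x ≡ₘ 1 ] ≈ 0#
      off-solution x ux x≢v = trans (*-congˡ (reflexive (if-no λ vx̄≡1 →
        x≢v (*-cancelʳ-unit (inv-unit ux) (≡.trans (*-inv ux) (≡.sym vx̄≡1)))))) (zeroʳ _)

    x₁-sum : ΣU (λ x₁ → e (x₁ ℕ.+ (n ℕ.* inv x₁) % p)) ≈ S n 1
    x₁-sum = begin
      ΣU (λ x₁ → e (x₁ ℕ.+ (n ℕ.* inv x₁) % p))                          ≈⟨ ΣU-scale (λ x₁ → e (x₁ ℕ.+ (n ℕ.* inv x₁) % p)) un ⟩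
      ΣU (λ x → e ((n ℕ.* x) % p ℕ.+ (n ℕ.* inv ((n ℕ.* x) % p)) % p))   ≈⟨ ΣU-cong (λ x ux → reflexive (e-cong (exponent ux))) ⟩
      ΣU (λ x → e (x ℕ.* n ℕ.+ 1 ℕ.* inv x))                             ∎
      where
      exponent : ∀ {x} → Unit x → (n ℕ.* x) % p ℕ.+ (n ℕ.* inv ((n ℕ.* x) % p)) % p ≡ₘ x ℕ.* n ℕ.+ 1 ℕ.* inv x
      exponent {x} ux = +-congₘ (≡.trans (%-≡ₘ (n ℕ.* x)) (≡⇒≡ₘ (ℕP.*-comm n x)))
                                (≡.trans (%-≡ₘ _) (≡.trans (inv-% un ux) (≡⇒≡ₘ (≡.sym (ℕP.*-identityˡ (inv x))))))

    phase : ℕ → ℕ → ℕ → Carrier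
    phase u x₁ x₂ = e (u ℕ.* ratio n x₁ x₂ ℕ.+ neg u)

    twistedKl-units : twistedKl n ≈ ΣU (λ u → ΣU (λ x₁ → ΣU (λ x₂ → e (x₁ ℕ.+ x₂) * phase u x₁ x₂)))
    twistedKl-units =
      Σ≈ΣU _ (Σ-zero p λ x₁ → Σ-zero p λ x₂ → Σ-zero p λ x₃ → term-u≡0 (toℕ x₁) (toℕ x₂) (toℕ x₃)) λ u uu →
      Σ≈ΣU _ (Σ-zero p λ x₂ → Σ-zero p λ x₃ → term-x₁≡0 u (toℕ x₂) (toℕ x₃)) λ x₁ ux₁ →
      Σ≈ΣU _ (Σ-zero p λ x₃ → term-x₂≡0 u x₁ (toℕ x₃)) λ x₂ ux₂ →
      x₃-sum uu ux₁ ux₂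

    u-sum-innermost : ΣU (λ u → ΣU (λ x₁ → ΣU (λ x₂ → e (x₁ ℕ.+ x₂) * phase u x₁ x₂)))
                    ≈ ΣU (λ x₁ → ΣU (λ x₂ → e (x₁ ℕ.+ x₂) * ΣU (λ u → phase u x₁ x₂)))
    u-sum-innermost =
      trans (ΣU-comm (λ u x₁ → ΣU (λ x₂ → e (x₁ ℕ.+ x₂) * phase u x₁ x₂))) (ΣU-cong λ x₁ _ →
      trans (ΣU-comm (λ u x₂ → e (x₁ ℕ.+ x₂) * phase u x₁ x₂)) (ΣU-cong λ x₂ _ →
      ΣU-*ˡ (e (x₁ ℕ.+ x₂)) (λ u → phase u x₁ x₂)))

    x₂-sum-of-u-sum : ∀ {x₁} → Unit x₁ →
      ΣU (λ x₂ → e (x₁ ℕ.+ x₂) * ΣU (λ u → phase u x₁ x₂)) ≈ ι p * e (x₁ ℕ.+ (n ℕ.* inv x₁) % p) - e x₁ * ΣU e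
    x₂-sum-of-u-sum {x₁} ux₁ = begin
      ΣU (λ x₂ → E x₂ * ΣU (λ u → phase u x₁ x₂))  ≈⟨ ΣU-cong {g = λ x₂ → ι p * (E x₂ * δ x₂) - E x₂}
                                                          (λ x₂ _ → trans (*-congˡ (orthogonality (ratio n x₁ x₂))) (*-affine _ _ _)) ⟩
      ΣU (λ x₂ → ι p * (E x₂ * δ x₂) - E x₂)        ≈⟨ ΣU-lin (ι p) (λ x₂ → E x₂ * δ x₂) E ⟩
      ι p * ΣU (λ x₂ → E x₂ * δ x₂) - ΣU E           ≈⟨ +-cong (*-congˡ (x₂-sum ux₁)) (-‿cong ΣU-E) ⟩
      ι p * e (x₁ ℕ.+ (n ℕ.* inv x₁) % p) - e x₁ * ΣU e  ∎
      where
      E δ : ℕ → Carrier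
      E x₂ = e (x₁ ℕ.+ x₂)
      δ x₂ = 𝟙[ ratio n x₁ x₂ ≡ₘ 1 ]
      ΣU-E : ΣU E ≈ e x₁ * ΣU e
      ΣU-E = trans (ΣU-cong {g = λ x₂ → e x₁ * e x₂} (λ x₂ _ → e-+ x₁ x₂)) (ΣU-*ˡ (e x₁) e)

    twistedKl-evaluation : twistedKl n ≈ ι p * S n 1 - 1#
    twistedKl-evaluation = begin
      twistedKl n                                                   ≈⟨ trans twistedKl-units u-sum-innermost ⟩
      ΣU (λ x₁ → ΣU (λ x₂ → e (x₁ ℕ.+ x₂) * ΣU (λ u → phase u x₁ x₂)))
        ≈⟨ ΣU-cong {g = λ x₁ → ι p * A x₁ - e x₁ * ΣU e} (λ x₁ ux₁ → x₂-sum-of-u-sum ux₁) ⟩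
      ΣU (λ x₁ → ι p * A x₁ - e x₁ * ΣU e)                          ≈⟨ ΣU-lin (ι p) A (λ x₁ → e x₁ * ΣU e) ⟩
      ι p * ΣU A - ΣU (λ x₁ → e x₁ * ΣU e)                          ≈⟨ +-cong (*-congˡ x₁-sum) (-‿cong ΣU-e²) ⟩
      ι p * S n 1 - 1#                                              ∎
      where
      A : ℕ → Carrier
      A x₁ = e (x₁ ℕ.+ (n ℕ.* inv x₁) % p)
      ΣU-e² : ΣU (λ x₁ → e x₁ * ΣU e) ≈ 1#
      ΣU-e² = begin
        ΣU (λ x₁ → e x₁ * ΣU e)  ≈⟨ ΣU-cong {g = λ x₁ → ΣU e * e x₁} (λ x₁ _ → *-comm _ _) ⟩
        ΣU (λ x₁ → ΣU e * e x₁)  ≈⟨ ΣU-*ˡ (ΣU e) e ⟩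
        ΣU e * ΣU e              ≈⟨ *-cong ΣU-e ΣU-e ⟩
        - 1# * - 1#              ≈⟨ -1*x≈-x (- 1#) ⟩
        - - 1#                   ≈⟨ -‿involutive 1# ⟩
        1#                       ∎

  ξe : OL → Carrier
  ξe t = ξ t * e (neg (Tr t))

  Nm%p : ∀ t → Nm t % p ≡ Nm t
  Nm%p t = %-≡ₘ _

  module Evaluation (prim : PrimRoot) (nonsquare : ¬ (∃ λ x → red (x ℕ.* x) ≡ red ε)) where
    open AdditiveCharacter prim

    W : OL → Carrier
    W t = if isZeroL t then 0# else ξe t * (ι p * S (Nm t) 1 - 1#)

    H-summand : ℕ → OL → Carrier
    H-summand m t = if isZeroL t then 0# else if ⌊ Nm t ℕ.≟ red (m ℕ.* 1) ⌋ then ξe t else 0#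

    H-expansion : ∀ m → H m 1 ≈ γ' * ΣL (H-summand m)
    H-expansion m with red (m ℕ.* 1) ℕ.≟ 0
    ... | no _    = refl
    ... | yes m≡0 = sym (trans (*-congˡ (ΣL-zero vanish)) (zeroʳ γ'))
      where
      vanish : ∀ t → H-summand m t ≈ 0#
      vanish t with isZeroL t in t≢0
      ... | true  = refl
      ... | false = reflexive (if-no λ Nm≡ → Nm-unit nonsquare t≢0 (≡.trans (≡.cong (_% p) (≡.trans Nm≡ m≡0)) 0%p))

    fibre-sum : ∀ t → Σ⁴ (λ u x₁ x₂ x₃ → ψ₀ u * e (x₁ ℕ.+ x₂ ℕ.+ x₃ ℕ.+ neg u) * H-summand (inv u ℕ.* x₁ ℕ.* x₂ ℕ.* x₃) t)
                    ≈ W t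
    fibre-sum t with isZeroL t in t≢0
    ... | true  = Σ⁴-zero {λ u x₁ x₂ x₃ → ψ₀ u * e (x₁ ℕ.+ x₂ ℕ.+ x₃ ℕ.+ neg u) * 0#} (λ _ _ _ _ → zeroʳ _)
    ... | false = begin
      Σ⁴ (λ u x₁ x₂ x₃ → ψ₀ u * e (x₁ ℕ.+ x₂ ℕ.+ x₃ ℕ.+ neg u) *
                         (if ⌊ Nm t ℕ.≟ red (inv u ℕ.* x₁ ℕ.* x₂ ℕ.* x₃ ℕ.* 1) ⌋ then ξe t else 0#))
        ≈⟨ Σ⁴-cong summand ⟩
      Σ⁴ (λ u x₁ x₂ x₃ → ξe t * twistedKl-term (Nm t) u x₁ x₂ x₃)
        ≈⟨ Σ⁴-*ˡ (ξe t) (twistedKl-term (Nm t)) ⟩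
      ξe t * twistedKl (Nm t)
        ≈⟨ *-congˡ (TwistedKloosterman.twistedKl-evaluation prim (m%n<n _ p) (Nm-unit nonsquare t≢0)) ⟩
      ξe t * (ι p * S (Nm t) 1 - 1#)
        ∎
      where
      summand : ∀ u x₁ x₂ x₃ → ψ₀ u * e (x₁ ℕ.+ x₂ ℕ.+ x₃ ℕ.+ neg u) *
                  (if ⌊ Nm t ℕ.≟ red (inv u ℕ.* x₁ ℕ.* x₂ ℕ.* x₃ ℕ.* 1) ⌋ then ξe t else 0#)
                ≈ ξe t * twistedKl-term (Nm t) u x₁ x₂ x₃
      summand u x₁ x₂ x₃ with Nm t ℕ.≟ red (inv u ℕ.* x₁ ℕ.* x₂ ℕ.* x₃ ℕ.* 1)
      ... | yes _ = *-comm _ _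
      ... | no _  = trans (zeroʳ _) (sym (zeroʳ _))

    Hhat₀-expansion : Hhat₀ ≈ pinv * pinv * (γ' * ΣL W)
    Hhat₀-expansion = *-congˡ (begin
      Σ⁴ (λ u x₁ x₂ x₃ → ψ₀ u * H (m u x₁ x₂ x₃) 1 * e (E u x₁ x₂ x₃))
        ≈⟨ Σ⁴-cong {g = λ u x₁ x₂ x₃ → γ' * ΣL (T u x₁ x₂ x₃)}
             (λ u x₁ x₂ x₃ → trans (*-congʳ (*-congˡ (H-expansion (m u x₁ x₂ x₃)))) (pull-out _ γ' (H-summand (m u x₁ x₂ x₃)) _)) ⟩
      Σ⁴ (λ u x₁ x₂ x₃ → γ' * ΣL (T u x₁ x₂ x₃))
        ≈⟨ Σ⁴-*ˡ γ' (λ u x₁ x₂ x₃ → ΣL (T u x₁ x₂ x₃)) ⟩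
      γ' * Σ⁴ (λ u x₁ x₂ x₃ → ΣL (T u x₁ x₂ x₃))
        ≈⟨ *-congˡ (Σ⁴-ΣL-comm T) ⟩
      γ' * ΣL (λ t → Σ⁴ (λ u x₁ x₂ x₃ → T u x₁ x₂ x₃ t))
        ≈⟨ *-congˡ (ΣL-cong fibre-sum) ⟩
      γ' * ΣL W
        ∎)
      where
      m E : ℕ → ℕ → ℕ → ℕ → ℕ
      m u x₁ x₂ x₃ = inv u ℕ.* x₁ ℕ.* x₂ ℕ.* x₃
      E u x₁ x₂ x₃ = x₁ ℕ.+ x₂ ℕ.+ x₃ ℕ.+ neg u
      T : ℕ → ℕ → ℕ → ℕ → OL → Carrier
      T u x₁ x₂ x₃ t = ψ₀ u * e (E u x₁ x₂ x₃) * H-summand (m u x₁ x₂ x₃) t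
      pull-out : ∀ a g (f : OL → Carrier) c → a * (g * ΣL f) * c ≈ g * ΣL (λ t → a * c * f t)
      pull-out a g f c = begin
        a * (g * ΣL f) * c          ≈⟨ ℛ.solve 4 (λ a g s c → a ℛ.:* (g ℛ.:* s) ℛ.:* c ℛ.:= g ℛ.:* (a ℛ.:* c ℛ.:* s)) refl a g (ΣL f) c ⟩
        g * (a * c * ΣL f)          ≈⟨ *-congˡ (ΣL-*ˡ (a * c) f) ⟨
        g * ΣL (λ t → a * c * f t)  ∎

    Klns-S-expansion : ΣU (λ y → Klns y * S y 1) ≈ ΣL (λ t → if isZeroL t then 0# else ξe t * S (Nm t) 1)
    Klns-S-expansion = begin
      ΣU (λ y → Klns y * S y 1)                    ≈⟨ ΣU-cong {g = λ y → ΣL (λ t → K y t * S y 1)} (λ y _ → ΣL-*ʳ) ⟩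
      ΣU (λ y → ΣL (λ t → K y t * S y 1))          ≈⟨ ΣU-ΣL-comm (λ y t → K y t * S y 1) ⟩
      ΣL (λ t → ΣU (λ y → K y t * S y 1))          ≈⟨ ΣL-cong fibre ⟩
      ΣL (λ t → if isZeroL t then 0# else ξe t * S (Nm t) 1) ∎
      where
      K : ℕ → OL → Carrier
      K y t = if ⌊ Nm t ℕ.≟ red y ⌋ then ξe t else 0#
      ΣL-*ʳ : ∀ {y} → ΣL (K y) * S y 1 ≈ ΣL (λ t → K y t * S y 1)
      ΣL-*ʳ {y} = trans (*-comm _ _) (trans (sym (ΣL-*ˡ (S y 1) (K y))) (ΣL-cong {g = λ t → K y t * S y 1} λ t → *-comm _ _))
      fibre : ∀ t → ΣU (λ y → K y t * S y 1) ≈ (if isZeroL t then 0# else ξe t * S (Nm t) 1)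
      fibre t with isZeroL t in isZero-t
      ... | true  = ΣU-zero {λ y → K y t * S y 1} λ y uy →
        trans (*-congʳ (reflexive (if-no λ Nm≡y → uy (≡.trans (≡.sym Nm≡y) (Nm-isZeroL isZero-t))))) (zeroˡ _)
      ... | false = begin
        ΣU (λ y → K y t * S y 1)                   ≈⟨ ΣU-single (λ y → K y t * S y 1) (Nm-unit nonsquare isZero-t) off-norm ⟩
        K (Nm t % p) t * S (Nm t % p) 1            ≡⟨ ≡.cong (λ y → K y t * S y 1) (Nm%p t) ⟩
        K (Nm t) t * S (Nm t) 1                    ≡⟨ ≡.cong (_* S (Nm t) 1) (if-yes (≡.sym (Nm%p t))) ⟩
        ξe t * S (Nm t) 1                          ∎
        where
        off-norm : ∀ y → Unit y → ¬ y ≡ₘ Nm t → K y t * S y 1 ≈ 0#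
        off-norm y _ y≢Nm = trans (*-congʳ (reflexive (if-no λ Nm≡y → y≢Nm (≡.trans (≡.sym Nm≡y) (≡.sym (Nm%p t)))))) (zeroˡ _)

    rhs-expansion : ι p * ΣU (λ y → Klns y * S y 1) - τL ≈ ΣL W
    rhs-expansion = begin
      ι p * ΣU (λ y → Klns y * S y 1) - τL    ≈⟨ +-congʳ (*-congˡ Klns-S-expansion) ⟩
      ι p * ΣL V - ΣL τ                        ≈⟨ ΣL-lin (ι p) V τ ⟨
      ΣL (λ t → ι p * V t - τ t)               ≈⟨ ΣL-cong pointwise ⟩
      ΣL W                                     ∎
      where
      V τ : OL → Carrier
      V t = if isZeroL t then 0# else ξe t * S (Nm t) 1
      τ t = if isZeroL t then 0# else ξe t
      pointwise : ∀ t → ι p * V t - τ t ≈ W t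
      pointwise t with isZeroL t
      ... | true  = trans (+-cong (zeroʳ (ι p)) -0#≈0#) (+-identityʳ 0#)
      ... | false = sym (*-affine (ξe t) (ι p) (S (Nm t) 1))

lemma5p18 : ∀ {c ℓ} (R : CommutativeRing c ℓ) (p : ℕ) (pp : Prime p) → ¬ (p ≡ 2)
  → (ε : ℕ) (ζ γ γ' pinv : CommutativeRing.Carrier R) (ξ : ℕ × ℕ → CommutativeRing.Carrier R)
  → let open CommutativeRing R
        open Setting R p pp ε ζ γ' pinv ξ
    in ¬ (red ε ≡ 0)
  → ¬ (∃ λ (x : ℕ) → red (x ℕ.* x) ≡ red ε)
  → γ * γ' ≈ 1#
  → ι p * pinv ≈ 1#
  → PrimRoot
  → CharHyp
  → γ * pow (ι p) 2 * Hhat₀ ≈ ι p * ΣU (λ y → Klns y * S y 1) - τL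
lemma5p18 R p pp _ ε ζ γ γ' pinv ξ _ nonsquare γγ'≈1 p·pinv≈1 prim _ = begin
  γ * pow (ι p) 2 * Hhat₀                         ≈⟨ *-congˡ Hhat₀-expansion ⟩
  γ * pow (ι p) 2 * (pinv * pinv * (γ' * ΣL W))   ≈⟨ cancel-scalars (ΣL W) γγ'≈1 p·pinv≈1 ⟩
  ΣL W                                            ≈⟨ rhs-expansion ⟨
  ι p * ΣU (λ y → Klns y * S y 1) - τL            ∎
  where
  open CommutativeRing R
  open Setting R p pp ε ζ γ' pinv ξ
  open HhatIdentity R p pp ε ζ γ' pinv ξ
  open Evaluation prim nonsquare
  open SetoidReasoning setoid
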